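{- Let $n\ge 7$. The minimum of $c_5(T)$ over all $T\in RB_U(n)$ is attained at the tree in which every internal vertex is maximally balanced.
   Context: $RB_U(n)$ is the set of unlabelled rooted binary trees (every non-leaf vertex has exactly two unordered children) with $n$ leaves. An internal vertex is maximally balanced if the numbers of leaves of the two subtrees rooted at its children differ by at most one; there is a unique tree in $RB_U(n)$ in which every internal vertex is maximally balanced (the most balanced tree). $Comb_5$ is the 5-leaf shape in which every non-leaf vertex has a leaf child. For a tree $T$ and a set $A$ of its leaves, $T|_A$ is the restriction tree (vertices: elements of $A$ and lowest common ancestors of pairs of them, ancestry inherited from $T$). $c_5(T)$ is the number of 5-element subsets $A$ of the leaves of $T$ such that $T|_A$ has shape $Comb_5$. -}

module Defs where

open import Data.Nat using (ℕ; zero; suc; _+_; _≤_; ∣_-_∣)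
open import Data.Bool using (Bool; true; false; if_then_else_; _∧_)
open import Data.Maybe using (Maybe; just; nothing)
open import Data.Vec using (Vec; []; _∷_; take; drop)
open import Data.List using (List; []; _∷_; map; _++_; filter; length)
open import Data.Fin.Subset using (Subset; ∣_∣; inside; outside)
open import Data.Unit using (⊤)
open import Data.Product using (_×_)
open import Relation.Binary.PropositionalEquality using (_≡_)
open import Relation.Nullary.Decidable using (does)
import Data.Nat as ℕ
import Data.Bool as Bool

-- Rooted binary trees (planar representatives; an unlabelled tree in RB_U(n)
-- is the class of such trees under swapping children; every quantity below is
-- invariant under swapping children).
data Tree : Set where
  leaf : Tree
  node : Tree → Tree → Tree

leaves : Tree → ℕ
leaves leaf       = 1
leaves (node l r) = leaves l + leaves r

AllMaxBalanced : Tree → Set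
AllMaxBalanced leaf       = ⊤
AllMaxBalanced (node l r) =
  (∣ leaves l - leaves r ∣ ≤ 1) × (AllMaxBalanced l × AllMaxBalanced r)

-- Restriction tree T|_A, where A is a subset of the leaves of T (leaves
-- indexed left to right). Vertices of degree two are suppressed, so the
-- vertices are exactly A and the lcas of pairs in A.
-- nothing stands for the empty restriction.
joinR : Maybe Tree → Maybe Tree → Maybe Tree
joinR (just a) (just b) = just (node a b)
joinR (just a) nothing  = just a
joinR nothing  b        = b

restrict : (t : Tree) → Subset (leaves t) → Maybe Tree
restrict leaf       (b ∷ []) = if b then just leaf else nothing
restrict (node l r) v =
  joinR (restrict l (take (leaves l) v)) (restrict r (drop (leaves l) v))

isComb : Tree → Bool
isComb leaf              = true
isComb (node leaf t)     = isComb t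
isComb (node t leaf)     = isComb t
isComb (node (node _ _) (node _ _)) = false

isComb5 : Maybe Tree → Bool
isComb5 nothing  = false
isComb5 (just t) = does (leaves t ℕ.≟ 5) ∧ isComb t

allSubsets : (n : ℕ) → List (Subset n)
allSubsets zero    = [] ∷ []
allSubsets (suc n) = map (inside ∷_) (allSubsets n) ++ map (outside ∷_) (allSubsets n)

c5 : Tree → ℕ
c5 t = length (filter (λ A → does (∣ A ∣ ℕ.≟ 5) ∧ isComb5 (restrict t A) Bool.≟ true) (allSubsets (leaves t)))

-- A comb with at least three leaves inside a tree node l r keeps all of its leaves but at most one
-- on the same side of the root. Hence c₄ (l r) = c₄ l + c₄ r + |l|·C(|r|,3) + |r|·C(|l|,3) and
-- c₅ (l r) = c₅ l + c₅ r + |l|·c₄ r + |r|·c₄ l, so the profile (leaves, c₄, c₅) of a tree is a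
-- function ⊗ of the profiles of its two subtrees, and all maximally balanced trees with n leaves
-- share one profile B n. By induction on the tree it suffices that B (a + b) ≼ B a ⊗ B b, i.e. that
-- no tree whose two root subtrees are balanced beats the balanced tree. For 1 ≤ a ≤ b, cut a and b
-- into halves and pair them crosswise, ((⌊a/2⌋ ⌈b/2⌉) (⌈a/2⌉ ⌊b/2⌋)): the root of this tree is
-- balanced, so by strong induction its profile dominates B (a + b), and uncrossing it into
-- ((⌊a/2⌋ ⌈a/2⌉) (⌊b/2⌋ ⌈b/2⌉)) does not decrease c₄ or c₅, by two polynomial inequalities in the
-- four quarter sizes.

module Submission where

open import Defs
open import Data.Nat using (ℕ; _≤_)
open import Relation.Binary.PropositionalEquality using (_≡_)

open import Data.Bool using (Bool; true; false; _∧_)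
open import Data.Bool.Properties using (∧-zeroʳ)
open import Data.Empty using (⊥-elim)
open import Data.Fin.Subset using (Subset; ∣_∣; inside; outside)
open import Data.List using (List; []; _∷_; map; _++_; filter; length)
open import Data.Maybe using (Maybe; just; nothing)
open import Data.Nat using (zero; suc; _+_; _*_; _<_; _≡ᵇ_; z≤n; s≤s; ∣_-_∣; ⌊_/2⌋; ⌈_/2⌉; _<?_)
open import Data.Nat.Induction using (<-rec)
open import Data.Nat.Properties
open import Data.Nat.Solver using (module +-*-Solver)
open import Data.Nat.Tactic.RingSolver using (solve-∀)
open import Data.Product using (∃; _×_; _,_; proj₁; proj₂)
open import Data.Sum using (_⊎_; inj₁; inj₂)
open import Data.Unit using (tt)
open import Data.Vec using ([]; _∷_; take; drop)
open import Relation.Binary.Bundles using (Preorder)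
open import Relation.Binary.PropositionalEquality
  using (_≢_; refl; sym; trans; cong; cong₂; subst; subst₂; isEquivalence; module ≡-Reasoning)
open import Relation.Nullary using (yes; no)
open import Relation.Nullary.Decidable using (does)
import Data.Bool as Bool
import Data.Nat as ℕ

-- Sums over lists

∑ : {A : Set} → List A → (A → ℕ) → ℕ
∑ []       f = 0
∑ (x ∷ xs) f = f x + ∑ xs f

module _ {A : Set} where

  ∑-++ : ∀ (xs ys : List A) f → ∑ (xs ++ ys) f ≡ ∑ xs f + ∑ ys f
  ∑-++ []       ys f = refl
  ∑-++ (x ∷ xs) ys f = trans (cong (f x +_) (∑-++ xs ys f)) (sym (+-assoc (f x) _ _))

  ∑-map : ∀ {B : Set} (g : B → A) xs f → ∑ (map g xs) f ≡ ∑ xs (λ x → f (g x))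
  ∑-map g []       f = refl
  ∑-map g (x ∷ xs) f = cong (f (g x) +_) (∑-map g xs f)

  ∑-cong : ∀ (xs : List A) {f g} → (∀ x → f x ≡ g x) → ∑ xs f ≡ ∑ xs g
  ∑-cong []       f≗g = refl
  ∑-cong (x ∷ xs) f≗g = cong₂ _+_ (f≗g x) (∑-cong xs f≗g)

  ∑-zero : ∀ (xs : List A) → ∑ xs (λ _ → 0) ≡ 0
  ∑-zero []       = refl
  ∑-zero (x ∷ xs) = ∑-zero xs

  ∑-+ : ∀ (xs : List A) f g → ∑ xs (λ x → f x + g x) ≡ ∑ xs f + ∑ xs g
  ∑-+ []       f g = refl
  ∑-+ (x ∷ xs) f g = trans (cong (f x + g x +_) (∑-+ xs f g)) (shuffle (f x) (g x) _ _)
    where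
    shuffle : ∀ a b c d → a + b + (c + d) ≡ a + c + (b + d)
    shuffle = solve-∀

  ∑-*ˡ : ∀ (xs : List A) c f → ∑ xs (λ x → c * f x) ≡ c * ∑ xs f
  ∑-*ˡ []       c f = sym (*-zeroʳ c)
  ∑-*ˡ (x ∷ xs) c f = trans (cong (c * f x +_) (∑-*ˡ xs c f)) (sym (*-distribˡ-+ c (f x) _))

  ∑-*ʳ : ∀ (xs : List A) c f → ∑ xs (λ x → f x * c) ≡ ∑ xs f * c
  ∑-*ʳ []       c f = refl
  ∑-*ʳ (x ∷ xs) c f = trans (cong (f x * c +_) (∑-*ʳ xs c f)) (sym (*-distribʳ-+ c (f x) _))

∑∑-* : ∀ {A B : Set} (xs : List A) (ys : List B) f g →
  ∑ xs (λ x → ∑ ys (λ y → f x * g y)) ≡ ∑ xs f * ∑ ys g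
∑∑-* xs ys f g = trans (∑-cong xs (λ x → ∑-*ˡ ys (f x) g)) (∑-*ʳ xs (∑ ys g) f)

∑-allSubsets-suc : ∀ n f → ∑ (allSubsets (suc n)) f
  ≡ ∑ (allSubsets n) (λ A → f (inside ∷ A)) + ∑ (allSubsets n) (λ A → f (outside ∷ A))
∑-allSubsets-suc n f = trans (∑-++ (map (inside ∷_) (allSubsets n)) _ f)
  (cong₂ _+_ (∑-map (inside ∷_) (allSubsets n) f) (∑-map (outside ∷_) (allSubsets n) f))

∑-allSubsets-+ : ∀ a b (g : Subset a → Subset b → ℕ) →
  ∑ (allSubsets (a + b)) (λ A → g (take a A) (drop a A)) ≡ ∑ (allSubsets a) (λ A → ∑ (allSubsets b) (g A))
∑-allSubsets-+ zero    b g = sym (+-identityʳ _)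
∑-allSubsets-+ (suc a) b g = begin
  ∑ (allSubsets (suc a + b)) (λ A → g (take (suc a) A) (drop (suc a) A))
    ≡⟨ ∑-allSubsets-suc (a + b) _ ⟩
  ∑ (allSubsets (a + b)) (λ A → g (inside ∷ take a A) (drop a A)) +
  ∑ (allSubsets (a + b)) (λ A → g (outside ∷ take a A) (drop a A))
    ≡⟨ cong₂ _+_ (∑-allSubsets-+ a b (λ A → g (inside ∷ A))) (∑-allSubsets-+ a b (λ A → g (outside ∷ A))) ⟩
  ∑ (allSubsets a) (λ A → ∑ (allSubsets b) (g (inside ∷ A))) +
  ∑ (allSubsets a) (λ A → ∑ (allSubsets b) (g (outside ∷ A)))
    ≡⟨ ∑-allSubsets-suc a _ ⟨
  ∑ (allSubsets (suc a)) (λ A → ∑ (allSubsets b) (g A)) ∎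
  where open ≡-Reasoning

-- Binomial coefficients

choose₂ : ℕ → ℕ
choose₂ zero    = 0
choose₂ (suc n) = choose₂ n + n

choose₃ : ℕ → ℕ
choose₃ zero    = 0
choose₃ (suc n) = choose₃ n + choose₂ n

choose₂-+ : ∀ a b → choose₂ (a + b) ≡ choose₂ a + choose₂ b + a * b
choose₂-+ zero    b = sym (+-identityʳ (choose₂ b))
choose₂-+ (suc a) b = trans (cong (_+ (a + b)) (choose₂-+ a b)) (shuffle (choose₂ a) (choose₂ b) a b)
  where
  shuffle : ∀ x y a b → x + y + a * b + (a + b) ≡ x + a + y + (b + a * b)
  shuffle = solve-∀

choose₃-+ : ∀ a b → choose₃ (a + b) ≡ choose₃ a + choose₃ b + a * choose₂ b + choose₂ a * b
choose₃-+ zero    b = sym (trans (+-identityʳ _) (+-identityʳ (choose₃ b)))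
choose₃-+ (suc a) b = trans (cong₂ _+_ (choose₃-+ a b) (choose₂-+ a b))
                            (shuffle (choose₃ a) (choose₃ b) (choose₂ a) (choose₂ b) a b)
  where
  shuffle : ∀ x y u v a b → x + y + a * v + u * b + (u + v + a * b) ≡ x + u + y + (v + a * v) + (u + a) * b
  shuffle = solve-∀

choose₂-closed : ∀ n → 2 * choose₂ n + n ≡ n * n
choose₂-closed zero    = refl
choose₂-closed (suc n) = begin
  2 * (choose₂ n + n) + suc n       ≡⟨ shift (choose₂ n) n ⟩
  (2 * choose₂ n + n) + (2 * n + 1) ≡⟨ cong (_+ (2 * n + 1)) (choose₂-closed n) ⟩
  n * n + (2 * n + 1)               ≡⟨ square n ⟩
  suc n * suc n                     ∎
  where
  open ≡-Reasoning
  shift : ∀ c n → 2 * (c + n) + suc n ≡ (2 * c + n) + (2 * n + 1)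
  shift = solve-∀
  square : ∀ n → n * n + (2 * n + 1) ≡ suc n * suc n
  square = solve-∀

choose₃-closed : ∀ n → 6 * choose₃ n + 3 * (n * n) ≡ n * n * n + 2 * n
choose₃-closed zero    = refl
choose₃-closed (suc n) = begin
  6 * (choose₃ n + choose₂ n) + 3 * (suc n * suc n)
    ≡⟨ shift (choose₃ n) (choose₂ n) n ⟩
  (6 * choose₃ n + 3 * (n * n)) + 3 * (2 * choose₂ n + n) + (3 * n + 3)
    ≡⟨ cong₂ (λ u v → u + 3 * v + (3 * n + 3)) (choose₃-closed n) (choose₂-closed n) ⟩
  (n * n * n + 2 * n) + 3 * (n * n) + (3 * n + 3)
    ≡⟨ cube n ⟩
  suc n * suc n * suc n + 2 * suc n ∎
  where
  open ≡-Reasoning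
  shift : ∀ c d n → 6 * (c + d) + 3 * (suc n * suc n) ≡ (6 * c + 3 * (n * n)) + 3 * (2 * d + n) + (3 * n + 3)
  shift = solve-∀
  cube : ∀ n → (n * n * n + 2 * n) + 3 * (n * n) + (3 * n + 3) ≡ suc n * suc n * suc n + 2 * suc n
  cube = solve-∀

-- Counting combs

𝟙 : Bool → ℕ
𝟙 true  = 1
𝟙 false = 0

-- The empty restriction (nothing) counts as the comb with no leaves.
combInd : ℕ → Maybe Tree → ℕ
combInd k nothing  = 𝟙 (k ≡ᵇ 0)
combInd k (just t) = 𝟙 ((leaves t ≡ᵇ k) ∧ isComb t)

leaves-nonzero : ∀ t → ∃ λ m → leaves t ≡ suc m
leaves-nonzero leaf       = 0 , refl
leaves-nonzero (node l r) with leaves-nonzero l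
... | m , eq = m + leaves r , cong (_+ leaves r) eq

combInd-0-just : ∀ t → combInd 0 (just t) ≡ 0
combInd-0-just t with leaves t | leaves-nonzero t
... | _ | m , refl = refl

combInd-1-node : ∀ x y → combInd 1 (just (node x y)) ≡ 0
combInd-1-node x y with leaves x | leaves-nonzero x | leaves y | leaves-nonzero y
... | _ | m , refl | _ | n , refl rewrite +-suc m n = refl

combInd-node-leaf : ∀ k t → combInd (suc k) (just (node t leaf)) ≡ combInd k (just t)
combInd-node-leaf k leaf       = refl
combInd-node-leaf k (node x y) rewrite +-comm (leaves x + leaves y) 1 = refl

combInd-node-node : ∀ k w x y z → combInd k (just (node (node w x) (node y z))) ≡ 0
combInd-node-node k w x y z = cong 𝟙 (∧-zeroʳ _)

Weight : Set
Weight = Maybe Tree → ℕ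

Bilinear : Set
Bilinear = List (Weight × Weight)

⟪_⟫ : Bilinear → Maybe Tree → Maybe Tree → ℕ
⟪ ps ⟫ u v = ∑ ps (λ p → proj₁ p u * proj₂ p v)

-- A comb with k leaves on the leaves of a node is a k-comb on one side, or a single leaf on one side
-- and a (k − 1)-comb on the other; for k = 2 the two single-leaf cases coincide.
combSplits : ℕ → Bilinear
combSplits 0 = (combInd 0 , combInd 0) ∷ []
combSplits 1 = (combInd 0 , combInd 1) ∷ (combInd 1 , combInd 0) ∷ []
combSplits 2 = (combInd 0 , combInd 2) ∷ (combInd 2 , combInd 0) ∷ (combInd 1 , combInd 1) ∷ []
combSplits (suc (suc (suc j))) = let k = 3 + j; k′ = 2 + j in
  (combInd 0 , combInd k) ∷ (combInd k , combInd 0) ∷ (combInd 1 , combInd k′) ∷ (combInd k′ , combInd 1) ∷ []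

combInd-joinR₀ : ∀ u v → combInd 0 (joinR u v) ≡ ⟪ combSplits 0 ⟫ u v
combInd-joinR₀ nothing  v        = sym (trans (+-identityʳ _) (*-identityˡ _))
combInd-joinR₀ (just a) nothing  = sym (trans (+-identityʳ _) (*-identityʳ _))
combInd-joinR₀ (just a) (just b) rewrite combInd-0-just (node a b) | combInd-0-just a = refl

combInd-joinR₁ : ∀ u v → combInd 1 (joinR u v) ≡ ⟪ combSplits 1 ⟫ u v
combInd-joinR₁ nothing  v        = arith (combInd 1 v)
  where
  arith : ∀ z → z ≡ 1 * z + (0 + 0)
  arith = solve-∀
combInd-joinR₁ (just a) nothing  rewrite combInd-0-just a = arith (combInd 1 (just a))
  where
  arith : ∀ z → z ≡ 0 + (z * 1 + 0)
  arith = solve-∀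
combInd-joinR₁ (just a) (just b) rewrite combInd-1-node a b | combInd-0-just a | combInd-0-just b =
  arith (combInd 1 (just a))
  where
  arith : ∀ c → 0 ≡ 0 + (c * 0 + 0)
  arith = solve-∀

combInd-joinR₂ : ∀ u v → combInd 2 (joinR u v) ≡ ⟪ combSplits 2 ⟫ u v
combInd-joinR₂ nothing           v                 = arith (combInd 2 v) (combInd 0 v)
  where
  arith : ∀ z c → z ≡ 1 * z + (0 * c + (0 + 0))
  arith = solve-∀
combInd-joinR₂ (just a)          nothing           rewrite combInd-0-just a =
  arith (combInd 2 (just a)) (combInd 1 (just a))
  where
  arith : ∀ z c → z ≡ 0 + (z * 1 + (c * 0 + 0))
  arith = solve-∀
combInd-joinR₂ (just leaf)       (just leaf)       = refl
combInd-joinR₂ (just leaf)       (just (node x y)) rewrite combInd-1-node x y = refl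
combInd-joinR₂ (just (node x y)) (just leaf)
  rewrite combInd-node-leaf 1 (node x y) | combInd-1-node x y | combInd-0-just (node x y) =
  arith (combInd 2 (just (node x y)))
  where
  arith : ∀ c → 0 ≡ 0 * 0 + (c * 0 + (0 * 1 + 0))
  arith = solve-∀
combInd-joinR₂ (just (node w x)) (just (node y z))
  rewrite combInd-node-node 2 w x y z | combInd-0-just (node w x) | combInd-1-node w x
        | combInd-0-just (node y z) =
  arith (combInd 2 (just (node w x)))
  where
  arith : ∀ c → 0 ≡ 0 + (c * 0 + (0 + 0))
  arith = solve-∀

combInd-joinR₃₊ : ∀ j u v → combInd (3 + j) (joinR u v) ≡ ⟪ combSplits (3 + j) ⟫ u v
combInd-joinR₃₊ j nothing           v                 =
  arith (combInd (3 + j) v) (combInd 0 v) (combInd (2 + j) v) (combInd 1 v)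
  where
  arith : ∀ z a b c → z ≡ 1 * z + (0 * a + (0 * b + (0 * c + 0)))
  arith = solve-∀
combInd-joinR₃₊ j (just a)          nothing           rewrite combInd-0-just a =
  arith (combInd (3 + j) (just a)) (combInd 1 (just a)) (combInd (2 + j) (just a))
  where
  arith : ∀ z b c → z ≡ 0 + (z * 1 + (b * 0 + (c * 0 + 0)))
  arith = solve-∀
combInd-joinR₃₊ j (just leaf)       (just leaf)       = refl
combInd-joinR₃₊ j (just leaf)       (just (node x y)) = arith (combInd (2 + j) (just (node x y)))
  where
  arith : ∀ z → z ≡ 0 + (0 + (1 * z + (0 + 0)))
  arith = solve-∀
combInd-joinR₃₊ j (just (node x y)) (just leaf)
  rewrite combInd-node-leaf (2 + j) (node x y) | combInd-0-just (node x y) | combInd-1-node x y =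
  arith (combInd (2 + j) (just (node x y))) (combInd (3 + j) (just (node x y)))
  where
  arith : ∀ z c → z ≡ 0 * 0 + (c * 0 + (0 * 0 + (z * 1 + 0)))
  arith = solve-∀
combInd-joinR₃₊ j (just (node w x)) (just (node y z))
  rewrite combInd-node-node (3 + j) w x y z | combInd-0-just (node w x) | combInd-0-just (node y z)
        | combInd-1-node w x | combInd-1-node y z =
  arith (combInd (3 + j) (just (node w x))) (combInd (2 + j) (just (node w x)))
  where
  arith : ∀ p q → 0 ≡ 0 + (p * 0 + (0 + (q * 0 + 0)))
  arith = solve-∀

combInd-joinR : ∀ k u v → combInd k (joinR u v) ≡ ⟪ combSplits k ⟫ u v
combInd-joinR 0                   = combInd-joinR₀
combInd-joinR 1                   = combInd-joinR₁
combInd-joinR 2                   = combInd-joinR₂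
combInd-joinR (suc (suc (suc j))) = combInd-joinR₃₊ j

∑↾ : Tree → Weight → ℕ
∑↾ t w = ∑ (allSubsets (leaves t)) (λ A → w (restrict t A))

combs : ℕ → Tree → ℕ
combs k t = ∑↾ t (combInd k)

∑↾-cong : ∀ t {w w′ : Weight} → (∀ u → w u ≡ w′ u) → ∑↾ t w ≡ ∑↾ t w′
∑↾-cong t w≗w′ = ∑-cong (allSubsets (leaves t)) (λ A → w≗w′ (restrict t A))

∑↾∑↾-⟪⟫ : ∀ l r ps → ∑↾ l (λ u → ∑↾ r (⟪ ps ⟫ u)) ≡ ∑ ps (λ p → ∑↾ l (proj₁ p) * ∑↾ r (proj₂ p))
∑↾∑↾-⟪⟫ l r []             = trans (∑↾-cong l (λ _ → ∑-zero Rs)) (∑-zero Ls)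
  where
  Ls : List (Subset (leaves l))
  Ls = allSubsets (leaves l)
  Rs : List (Subset (leaves r))
  Rs = allSubsets (leaves r)
∑↾∑↾-⟪⟫ l r ((f , g) ∷ ps) = begin
  ∑ Ls (λ A → ∑ Rs (λ B → f (restrict l A) * g (restrict r B) + ⟪ ps ⟫ (restrict l A) (restrict r B)))
    ≡⟨ ∑-cong Ls (λ A → ∑-+ Rs _ _) ⟩
  ∑ Ls (λ A → ∑ Rs (λ B → f (restrict l A) * g (restrict r B)) + ∑↾ r (⟪ ps ⟫ (restrict l A)))
    ≡⟨ ∑-+ Ls _ _ ⟩
  ∑ Ls (λ A → ∑ Rs (λ B → f (restrict l A) * g (restrict r B))) + ∑↾ l (λ u → ∑↾ r (⟪ ps ⟫ u))
    ≡⟨ cong₂ _+_ (∑∑-* Ls Rs _ _) (∑↾∑↾-⟪⟫ l r ps) ⟩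
  ∑↾ l f * ∑↾ r g + ∑ ps (λ p → ∑↾ l (proj₁ p) * ∑↾ r (proj₂ p)) ∎
  where
  open ≡-Reasoning
  Ls : List (Subset (leaves l))
  Ls = allSubsets (leaves l)
  Rs : List (Subset (leaves r))
  Rs = allSubsets (leaves r)

combs-node : ∀ k l r → combs k (node l r) ≡ ∑ (combSplits k) (λ p → ∑↾ l (proj₁ p) * ∑↾ r (proj₂ p))
combs-node k l r = begin
  combs k (node l r)
    ≡⟨ ∑-allSubsets-+ (leaves l) (leaves r) (λ A B → combInd k (joinR (restrict l A) (restrict r B))) ⟩
  ∑↾ l (λ u → ∑↾ r (λ v → combInd k (joinR u v)))
    ≡⟨ ∑↾-cong l (λ u → ∑↾-cong r (combInd-joinR k u)) ⟩
  ∑↾ l (λ u → ∑↾ r (⟪ combSplits k ⟫ u))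
    ≡⟨ ∑↾∑↾-⟪⟫ l r (combSplits k) ⟩
  ∑ (combSplits k) (λ p → ∑↾ l (proj₁ p) * ∑↾ r (proj₂ p)) ∎
  where open ≡-Reasoning

combs-0 : ∀ t → combs 0 t ≡ 1
combs-0 leaf       = refl
combs-0 (node l r) rewrite combs-node 0 l r | combs-0 l | combs-0 r = refl

combs-1 : ∀ t → combs 1 t ≡ leaves t
combs-1 leaf       = refl
combs-1 (node l r) rewrite combs-node 1 l r | combs-0 l | combs-0 r | combs-1 l | combs-1 r =
  arith (leaves l) (leaves r)
  where
  arith : ∀ a b → 1 * b + (a * 1 + 0) ≡ a + b
  arith = solve-∀

combs-2 : ∀ t → combs 2 t ≡ choose₂ (leaves t)
combs-2 leaf       = refl
combs-2 (node l r)
  rewrite combs-node 2 l r | combs-0 l | combs-0 r | combs-1 l | combs-1 r | combs-2 l | combs-2 r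
        | choose₂-+ (leaves l) (leaves r) = arith (choose₂ (leaves l)) (choose₂ (leaves r)) (leaves l * leaves r)
  where
  arith : ∀ x y z → 1 * y + (x * 1 + (z + 0)) ≡ x + y + z
  arith = solve-∀

combs-node₃₊ : ∀ j l r → let k = 3 + j; k′ = 2 + j in
  combs k (node l r) ≡ combs k l + combs k r + leaves l * combs k′ r + leaves r * combs k′ l
combs-node₃₊ j l r rewrite combs-node (3 + j) l r | combs-0 l | combs-0 r | combs-1 l | combs-1 r =
  arith (combs (3 + j) l) (combs (3 + j) r) (leaves l) (leaves r) (combs (2 + j) l) (combs (2 + j) r)
  where
  arith : ∀ x y a b u v → 1 * y + (x * 1 + (a * v + (u * b + 0))) ≡ x + y + a * v + b * u
  arith = solve-∀

combs-3 : ∀ t → combs 3 t ≡ choose₃ (leaves t)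
combs-3 leaf       = refl
combs-3 (node l r)
  rewrite combs-node₃₊ 0 l r | combs-3 l | combs-3 r | combs-2 l | combs-2 r | choose₃-+ (leaves l) (leaves r) =
  cong (choose₃ (leaves l) + choose₃ (leaves r) + leaves l * choose₂ (leaves r) +_) (*-comm (leaves r) _)

cross₄ : ℕ → ℕ → ℕ
cross₄ a b = a * choose₃ b + b * choose₃ a

combs-4-node : ∀ l r → combs 4 (node l r) ≡ combs 4 l + combs 4 r + cross₄ (leaves l) (leaves r)
combs-4-node l r rewrite combs-node₃₊ 1 l r | combs-3 l | combs-3 r =
  +-assoc (combs 4 l + combs 4 r) (leaves l * choose₃ (leaves r)) (leaves r * choose₃ (leaves l))

combs-5-node : ∀ l r → combs 5 (node l r) ≡ combs 5 l + combs 5 r + leaves l * combs 4 r + leaves r * combs 4 l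
combs-5-node = combs-node₃₊ 2

leavesᵐ : Maybe Tree → ℕ
leavesᵐ nothing  = 0
leavesᵐ (just t) = leaves t

leavesᵐ-joinR : ∀ u v → leavesᵐ (joinR u v) ≡ leavesᵐ u + leavesᵐ v
leavesᵐ-joinR nothing  v        = refl
leavesᵐ-joinR (just a) nothing  = sym (+-identityʳ (leaves a))
leavesᵐ-joinR (just a) (just b) = refl

∣take∣+∣drop∣ : ∀ a {b} (A : Subset (a + b)) → ∣ take a A ∣ + ∣ drop a A ∣ ≡ ∣ A ∣
∣take∣+∣drop∣ zero    A           = refl
∣take∣+∣drop∣ (suc a) (true  ∷ A) = cong suc (∣take∣+∣drop∣ a A)
∣take∣+∣drop∣ (suc a) (false ∷ A) = ∣take∣+∣drop∣ a A

leavesᵐ-restrict : ∀ t A → leavesᵐ (restrict t A) ≡ ∣ A ∣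
leavesᵐ-restrict leaf       (true  ∷ []) = refl
leavesᵐ-restrict leaf       (false ∷ []) = refl
leavesᵐ-restrict (node l r) A = begin
  leavesᵐ (joinR (restrict l (take (leaves l) A)) (restrict r (drop (leaves l) A)))
    ≡⟨ leavesᵐ-joinR (restrict l (take (leaves l) A)) _ ⟩
  leavesᵐ (restrict l (take (leaves l) A)) + leavesᵐ (restrict r (drop (leaves l) A))
    ≡⟨ cong₂ _+_ (leavesᵐ-restrict l _) (leavesᵐ-restrict r _) ⟩
  ∣ take (leaves l) A ∣ + ∣ drop (leaves l) A ∣
    ≡⟨ ∣take∣+∣drop∣ (leaves l) A ⟩
  ∣ A ∣ ∎
  where open ≡-Reasoning

length-filter : ∀ {A : Set} (f : A → Bool) xs →
  length (filter (λ x → f x Bool.≟ true) xs) ≡ ∑ xs (λ x → 𝟙 (f x))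
length-filter f []       = refl
length-filter f (x ∷ xs) with f x
... | true  = cong suc (length-filter f xs)
... | false = length-filter f xs

isComb5-combInd : ∀ m → 𝟙 (does (leavesᵐ m ℕ.≟ 5) ∧ isComb5 m) ≡ combInd 5 m
isComb5-combInd nothing  = refl
isComb5-combInd (just t) with leaves t ≡ᵇ 5
... | true  = refl
... | false = refl

c5≡combs5 : ∀ t → c5 t ≡ combs 5 t
c5≡combs5 t = trans (length-filter _ (allSubsets (leaves t))) (∑-cong (allSubsets (leaves t)) λ A → begin
  𝟙 (does (∣ A ∣ ℕ.≟ 5) ∧ isComb5 (restrict t A))
    ≡⟨ cong (λ n → 𝟙 (does (n ℕ.≟ 5) ∧ isComb5 (restrict t A))) (leavesᵐ-restrict t A) ⟨
  𝟙 (does (leavesᵐ (restrict t A) ℕ.≟ 5) ∧ isComb5 (restrict t A))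
    ≡⟨ isComb5-combInd (restrict t A) ⟩
  combInd 5 (restrict t A) ∎)
  where open ≡-Reasoning

-- Two polynomial inequalities

-- The shapes are written over an arbitrary signature so that ShapeSyntax can hand them to the ring
-- solver. For F = cross₄, nested₄ and nested₅ are the contributions to c₄ and c₅ of the tree
-- ((a₁ a₂) (b₁ b₂)) that do not come from inside its four subtrees of these sizes.
module Shapes {A : Set} (plus times : A → A → A) (# : ℕ → A) where
  private
    infixl 6 _⊕_
    infixl 7 _⊙_
    _⊕_ _⊙_ : A → A → A
    _⊕_ = plus
    _⊙_ = times

  spread cubic tilt : A → A → A
  spread x y = # 3 ⊙ (x ⊙ y ⊙ (x ⊕ y))
  cubic  x y = x ⊙ y ⊙ (x ⊙ x ⊕ y ⊙ y ⊕ # 4)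
  tilt   x y = x ⊙ y ⊙ (x ⊕ y) ⊙ (# 2 ⊙ x ⊕ y)

  nested₄ nested₅ : (A → A → A) → A → A → A → A → A
  nested₄ F a₁ a₂ b₁ b₂ = F a₁ a₂ ⊕ F b₁ b₂ ⊕ F (a₁ ⊕ a₂) (b₁ ⊕ b₂)
  nested₅ F a₁ a₂ b₁ b₂ = (a₁ ⊕ a₂) ⊙ F b₁ b₂ ⊕ (b₁ ⊕ b₂) ⊙ F a₁ a₂

open Shapes _+_ _*_ (λ n → n)

module ShapeSyntax where
  open +-*-Solver public using (solve; _:=_; _:+_; _:*_; con; Polynomial)
  open Shapes {Polynomial 4} _:+_ _:*_ con public
    renaming (spread to :spread; cubic to :cubic; tilt to :tilt; nested₄ to :nested₄; nested₅ to :nested₅)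

sixfold-cross₄ : ∀ x y → 6 * cross₄ x y + spread x y ≡ cubic x y
sixfold-cross₄ x y = begin
  6 * (x * choose₃ y + y * choose₃ x) + 3 * (x * y * (x + y))
    ≡⟨ distribute x y (choose₃ y) (choose₃ x) ⟩
  x * (6 * choose₃ y + 3 * (y * y)) + y * (6 * choose₃ x + 3 * (x * x))
    ≡⟨ cong₂ (λ u v → x * u + y * v) (choose₃-closed y) (choose₃-closed x) ⟩
  x * (y * y * y + 2 * y) + y * (x * x * x + 2 * x)
    ≡⟨ collect x y ⟩
  x * y * (x * x + y * y + 4) ∎
  where
  open ≡-Reasoning
  distribute : ∀ x y u v →
    6 * (x * u + y * v) + 3 * (x * y * (x + y)) ≡ x * (6 * u + 3 * (y * y)) + y * (6 * v + 3 * (x * x))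
  distribute = solve-∀
  collect : ∀ x y → x * (y * y * y + 2 * y) + y * (x * x * x + 2 * x) ≡ x * y * (x * x + y * y + 4)
  collect = solve-∀

module _ (f g h : ℕ → ℕ → ℕ) (sixfold : ∀ x y → 6 * f x y + g x y ≡ h x y) where

  sixfold-nested₄ : ∀ a₁ a₂ b₁ b₂ →
    6 * nested₄ f a₁ a₂ b₁ b₂ + nested₄ g a₁ a₂ b₁ b₂ ≡ nested₄ h a₁ a₂ b₁ b₂
  sixfold-nested₄ a₁ a₂ b₁ b₂ = trans (regroup (f a₁ a₂) (f b₁ b₂) (f (a₁ + a₂) (b₁ + b₂)) _ _ _)
    (cong₂ _+_ (cong₂ _+_ (sixfold a₁ a₂) (sixfold b₁ b₂)) (sixfold (a₁ + a₂) (b₁ + b₂)))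
    where
    regroup : ∀ x y z u v w → 6 * (x + y + z) + (u + v + w) ≡ (6 * x + u) + (6 * y + v) + (6 * z + w)
    regroup = solve-∀

  sixfold-nested₅ : ∀ a₁ a₂ b₁ b₂ →
    6 * nested₅ f a₁ a₂ b₁ b₂ + nested₅ g a₁ a₂ b₁ b₂ ≡ nested₅ h a₁ a₂ b₁ b₂
  sixfold-nested₅ a₁ a₂ b₁ b₂ = trans (regroup (a₁ + a₂) (b₁ + b₂) (f b₁ b₂) (f a₁ a₂) _ _)
    (cong₂ _+_ (cong ((a₁ + a₂) *_) (sixfold b₁ b₂)) (cong ((b₁ + b₂) *_) (sixfold a₁ a₂)))
    where
    regroup : ∀ a b x y u v → 6 * (a * x + b * y) + (a * u + b * v) ≡ a * (6 * x + u) + b * (6 * y + v)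
    regroup = solve-∀

-- Compares l = (qₗ − kₗ) / 6 with r = (qᵣ − kᵣ) / 6 without subtracting in ℕ.
≤-from-sixfold : ∀ {l r kₗ kᵣ qₗ qᵣ} → 6 * l + kₗ ≡ qₗ → 6 * r + kᵣ ≡ qᵣ → qₗ + kᵣ ≤ qᵣ + kₗ → l ≤ r
≤-from-sixfold {l} {r} {kₗ} {kᵣ} {qₗ} {qᵣ} eqₗ eqᵣ q≤q =
  *-cancelˡ-≤ 6 (+-cancelʳ-≤ (kₗ + kᵣ) (6 * l) (6 * r) (begin
    6 * l + (kₗ + kᵣ) ≡⟨ +-assoc (6 * l) kₗ kᵣ ⟨
    6 * l + kₗ + kᵣ   ≡⟨ cong (_+ kᵣ) eqₗ ⟩
    qₗ + kᵣ           ≤⟨ q≤q ⟩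
    qᵣ + kₗ           ≡⟨ cong (_+ kₗ) eqᵣ ⟨
    6 * r + kᵣ + kₗ   ≡⟨ +-assoc (6 * r) kᵣ kₗ ⟩
    6 * r + (kᵣ + kₗ) ≡⟨ cong (6 * r +_) (+-comm kᵣ kₗ) ⟩
    6 * r + (kₗ + kᵣ) ∎))
  where open ≤-Reasoning

≤-of-≡+ : ∀ {x y t} → y ≡ x + t → x ≤ y
≤-of-≡+ {x} {t = t} eq = subst (x ≤_) (sym eq) (m≤m+n x t)

exchange-≤ : ∀ {x y s t} → y + s ≡ x + t → s ≤ t → x ≤ y
exchange-≤ {x} {y} {s} {t} eq s≤t = +-cancelʳ-≤ s x y (begin
  x + s ≤⟨ +-monoʳ-≤ x s≤t ⟩
  x + t ≡⟨ eq ⟨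
  y + s ∎)
  where open ≤-Reasoning

regroup-identity₄ : ∀ a₁ a₂ d e → let b₁ = a₁ + d; b₂ = a₂ + e in
  nested₄ cubic a₁ a₂ b₁ b₂ + nested₄ spread a₁ b₂ a₂ b₁
    ≡ nested₄ cubic a₁ b₂ a₂ b₁ + nested₄ spread a₁ a₂ b₁ b₂ + 3 * (d * e * (a₁ * b₁ + a₂ * b₂))
regroup-identity₄ = solve 4 (λ a₁ a₂ d e → let b₁ = a₁ :+ d; b₂ = a₂ :+ e in
  :nested₄ :cubic a₁ a₂ b₁ b₂ :+ :nested₄ :spread a₁ b₂ a₂ b₁
    := :nested₄ :cubic a₁ b₂ a₂ b₁ :+ :nested₄ :spread a₁ a₂ b₁ b₂ :+ con 3 :* (d :* e :* (a₁ :* b₁ :+ a₂ :* b₂)))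
  refl
  where open ShapeSyntax

-- Here the slack is e·a₁d(a₁ + d)(2a₁ + d − 3) + d·a₂e(a₂ + e)(2a₂ + e − 3), written as tilt − spread.
regroup-identity₅ : ∀ a₁ a₂ d e → let b₁ = a₁ + d; b₂ = a₂ + e in
  nested₅ cubic a₁ a₂ b₁ b₂ + nested₅ spread a₁ b₂ a₂ b₁ + (e * spread a₁ d + d * spread a₂ e)
    ≡ nested₅ cubic a₁ b₂ a₂ b₁ + nested₅ spread a₁ a₂ b₁ b₂ + (e * tilt a₁ d + d * tilt a₂ e)
regroup-identity₅ = solve 4 (λ a₁ a₂ d e → let b₁ = a₁ :+ d; b₂ = a₂ :+ e in
  :nested₅ :cubic a₁ a₂ b₁ b₂ :+ :nested₅ :spread a₁ b₂ a₂ b₁ :+ (e :* :spread a₁ d :+ d :* :spread a₂ e)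
    := :nested₅ :cubic a₁ b₂ a₂ b₁ :+ :nested₅ :spread a₁ a₂ b₁ b₂ :+ (e :* :tilt a₁ d :+ d :* :tilt a₂ e))
  refl
  where open ShapeSyntax

spread≤tilt : ∀ a d → spread a d ≤ tilt a d
spread≤tilt zero    d       = z≤n
spread≤tilt (suc a) zero    rewrite *-zeroʳ (suc a) = z≤n
spread≤tilt (suc a) (suc d) = begin
  3 * m                   ≡⟨ *-comm 3 m ⟩
  m * 3                   ≤⟨ *-monoʳ-≤ m (+-mono-≤ (*-monoʳ-≤ 2 (s≤s z≤n)) (s≤s z≤n)) ⟩
  m * (2 * suc a + suc d) ∎
  where
  open ≤-Reasoning
  m : ℕ
  m = suc a * suc d * (suc a + suc d)

nested₄-regroup : ∀ {a₁ a₂ b₁ b₂} → a₁ ≤ b₁ → a₂ ≤ b₂ →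
  nested₄ cross₄ a₁ b₂ a₂ b₁ ≤ nested₄ cross₄ a₁ a₂ b₁ b₂
nested₄-regroup {a₁} {a₂} a₁≤b₁ a₂≤b₂ with m≤n⇒∃[o]m+o≡n a₁≤b₁ | m≤n⇒∃[o]m+o≡n a₂≤b₂
... | d , refl | e , refl =
  ≤-from-sixfold (sixfold-nested₄ cross₄ spread cubic sixfold-cross₄ a₁ (a₂ + e) a₂ (a₁ + d))
                 (sixfold-nested₄ cross₄ spread cubic sixfold-cross₄ a₁ a₂ (a₁ + d) (a₂ + e))
                 (≤-of-≡+ (regroup-identity₄ a₁ a₂ d e))

nested₅-regroup : ∀ {a₁ a₂ b₁ b₂} → a₁ ≤ b₁ → a₂ ≤ b₂ →
  nested₅ cross₄ a₁ b₂ a₂ b₁ ≤ nested₅ cross₄ a₁ a₂ b₁ b₂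
nested₅-regroup {a₁} {a₂} a₁≤b₁ a₂≤b₂ with m≤n⇒∃[o]m+o≡n a₁≤b₁ | m≤n⇒∃[o]m+o≡n a₂≤b₂
... | d , refl | e , refl =
  ≤-from-sixfold (sixfold-nested₅ cross₄ spread cubic sixfold-cross₄ a₁ (a₂ + e) a₂ (a₁ + d))
                 (sixfold-nested₅ cross₄ spread cubic sixfold-cross₄ a₁ a₂ (a₁ + d) (a₂ + e))
                 (exchange-≤ (regroup-identity₅ a₁ a₂ d e)
                             (+-mono-≤ (*-monoʳ-≤ e (spread≤tilt a₁ d)) (*-monoʳ-≤ d (spread≤tilt a₂ e))))

-- Profiles

record Profile : Set where
  constructor ⟨_,_,_⟩
  field
    size combs₄ combs₅ : ℕ

open Profile

profile : Tree → Profile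
profile t = ⟨ leaves t , combs 4 t , combs 5 t ⟩

infixl 6 _⊗_

_⊗_ : Profile → Profile → Profile
⟨ a , u , s ⟩ ⊗ ⟨ b , v , t ⟩ = ⟨ a + b , u + v + cross₄ a b , s + t + a * v + b * u ⟩

⟨⟩-cong : ∀ {a a′ u u′ s s′} → a ≡ a′ → u ≡ u′ → s ≡ s′ → ⟨ a , u , s ⟩ ≡ ⟨ a′ , u′ , s′ ⟩
⟨⟩-cong refl refl refl = refl

profile-node : ∀ l r → profile (node l r) ≡ profile l ⊗ profile r
profile-node l r = ⟨⟩-cong refl (combs-4-node l r) (combs-5-node l r)

⊗-comm : ∀ p q → p ⊗ q ≡ q ⊗ p
⊗-comm ⟨ a , u , s ⟩ ⟨ b , v , t ⟩ =
  ⟨⟩-cong (+-comm a b) (cong₂ _+_ (+-comm u v) (+-comm (a * choose₃ b) _)) (swap s t a b u v)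
  where
  swap : ∀ s t a b u v → s + t + a * v + b * u ≡ t + s + b * u + a * v
  swap = solve-∀

infix 4 _≼_

record _≼_ (p q : Profile) : Set where
  field
    size≡   : size p ≡ size q
    combs₄≤ : combs₄ p ≤ combs₄ q
    combs₅≤ : combs₅ p ≤ combs₅ q

open _≼_

≼-reflexive : ∀ {p q} → p ≡ q → p ≼ q
≼-reflexive refl = record { size≡ = refl ; combs₄≤ = ≤-refl ; combs₅≤ = ≤-refl }

≼-trans : ∀ {p q r} → p ≼ q → q ≼ r → p ≼ r
≼-trans p≼q q≼r = record
  { size≡   = trans (size≡ p≼q) (size≡ q≼r)
  ; combs₄≤ = ≤-trans (combs₄≤ p≼q) (combs₄≤ q≼r)
  ; combs₅≤ = ≤-trans (combs₅≤ p≼q) (combs₅≤ q≼r)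
  }

≼-preorder : Preorder _ _ _
≼-preorder = record
  { Carrier    = Profile
  ; _≈_        = _≡_
  ; _≲_        = _≼_
  ; isPreorder = record { isEquivalence = isEquivalence ; reflexive = ≼-reflexive ; trans = ≼-trans }
  }

⊗-mono : ∀ {p p′ q q′} → p ≼ p′ → q ≼ q′ → p ⊗ q ≼ p′ ⊗ q′
⊗-mono p≼p′ q≼q′ = record
  { size≡   = cong₂ _+_ (size≡ p≼p′) (size≡ q≼q′)
  ; combs₄≤ = +-mono-≤ (+-mono-≤ (combs₄≤ p≼p′) (combs₄≤ q≼q′))
                       (≤-reflexive (cong₂ cross₄ (size≡ p≼p′) (size≡ q≼q′)))
  ; combs₅≤ = +-mono-≤ (+-mono-≤ (+-mono-≤ (combs₅≤ p≼p′) (combs₅≤ q≼q′))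
                                 (*-mono-≤ (≤-reflexive (size≡ p≼p′)) (combs₄≤ q≼q′)))
                       (*-mono-≤ (≤-reflexive (size≡ q≼q′)) (combs₄≤ p≼p′))
  }

⊗-regroup : ∀ {p₁ p₂ q₁ q₂} → size p₁ ≤ size q₁ → size p₂ ≤ size q₂ →
  (p₁ ⊗ q₂) ⊗ (p₂ ⊗ q₁) ≼ (p₁ ⊗ p₂) ⊗ (q₁ ⊗ q₂)
⊗-regroup {⟨ a₁ , u₁ , s₁ ⟩} {⟨ a₂ , u₂ , s₂ ⟩} {⟨ b₁ , w₁ , t₁ ⟩} {⟨ b₂ , w₂ , t₂ ⟩} a₁≤b₁ a₂≤b₂ =
  record
  { size≡   = sizes a₁ a₂ b₁ b₂
  ; combs₄≤ = exchange-≤ (exchange₄ u₁ u₂ w₁ w₂ (cross₄ a₁ b₂) (cross₄ a₂ b₁) _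
                                    (cross₄ a₁ a₂) (cross₄ b₁ b₂) _)
                         (nested₄-regroup a₁≤b₁ a₂≤b₂)
  ; combs₅≤ = exchange-≤ (exchange₅ a₁ a₂ b₁ b₂ u₁ u₂ w₁ w₂ s₁ s₂ t₁ t₂
                                    (cross₄ a₁ b₂) (cross₄ a₂ b₁) (cross₄ a₁ a₂) (cross₄ b₁ b₂))
                         (nested₅-regroup a₁≤b₁ a₂≤b₂)
  }
  where
  sizes : ∀ a₁ a₂ b₁ b₂ → (a₁ + b₂) + (a₂ + b₁) ≡ (a₁ + a₂) + (b₁ + b₂)
  sizes = solve-∀
  exchange₄ : ∀ u₁ u₂ w₁ w₂ x₁ x₂ x₃ y₁ y₂ y₃ →
    (u₁ + u₂ + y₁) + (w₁ + w₂ + y₂) + y₃ + (x₁ + x₂ + x₃)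
    ≡ (u₁ + w₂ + x₁) + (u₂ + w₁ + x₂) + x₃ + (y₁ + y₂ + y₃)
  exchange₄ = solve-∀
  exchange₅ : ∀ a₁ a₂ b₁ b₂ u₁ u₂ w₁ w₂ s₁ s₂ t₁ t₂ x₁ x₂ y₁ y₂ →
    (s₁ + s₂ + a₁ * u₂ + a₂ * u₁) + (t₁ + t₂ + b₁ * w₂ + b₂ * w₁)
      + (a₁ + a₂) * (w₁ + w₂ + y₂) + (b₁ + b₂) * (u₁ + u₂ + y₁) + ((a₁ + b₂) * x₂ + (a₂ + b₁) * x₁)
    ≡ (s₁ + t₂ + a₁ * w₂ + b₂ * u₁) + (s₂ + t₁ + a₂ * w₁ + b₁ * u₂)
      + (a₁ + b₂) * (u₂ + w₁ + x₂) + (a₂ + b₁) * (u₁ + w₂ + x₁) + ((a₁ + a₂) * y₂ + (b₁ + b₂) * y₁)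
  exchange₅ = solve-∀

-- Balanced trees

close⇒≤suc : ∀ {x y} → ∣ x - y ∣ ≤ 1 → x ≤ suc y
close⇒≤suc {x} {y} close = begin
  x             ≤⟨ m≤n+∣m-n∣ x y ⟩
  y + ∣ x - y ∣ ≤⟨ +-monoʳ-≤ y close ⟩
  y + 1         ≡⟨ +-comm y 1 ⟩
  suc y         ∎
  where open ≤-Reasoning

≤suc⇒close : ∀ {x y} → x ≤ suc y → y ≤ suc x → ∣ x - y ∣ ≤ 1
≤suc⇒close {zero}        {zero}        _         _         = z≤n
≤suc⇒close {zero}        {suc zero}    _         _         = ≤-refl
≤suc⇒close {zero}        {suc (suc y)} _         (s≤s ())
≤suc⇒close {suc zero}    {zero}        _         _         = ≤-refl
≤suc⇒close {suc (suc x)} {zero}        (s≤s ())  _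
≤suc⇒close {suc x}       {suc y}       (s≤s x≤y) (s≤s y≤x) = ≤suc⇒close x≤y y≤x

⌈n/2⌉≤1+⌊n/2⌋ : ∀ n → ⌈ n /2⌉ ≤ suc ⌊ n /2⌋
⌈n/2⌉≤1+⌊n/2⌋ zero          = z≤n
⌈n/2⌉≤1+⌊n/2⌋ (suc zero)    = ≤-refl
⌈n/2⌉≤1+⌊n/2⌋ (suc (suc n)) = s≤s (⌈n/2⌉≤1+⌊n/2⌋ n)

halves-close : ∀ n → ∣ ⌊ n /2⌋ - ⌈ n /2⌉ ∣ ≤ 1
halves-close n = ≤suc⇒close (m≤n⇒m≤1+n (⌊n/2⌋≤⌈n/2⌉ n)) (⌈n/2⌉≤1+⌊n/2⌋ n)

crossed-halves-close : ∀ a b → ∣ ⌊ a /2⌋ + ⌈ b /2⌉ - ⌈ a /2⌉ + ⌊ b /2⌋ ∣ ≤ 1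
crossed-halves-close a b = ≤suc⇒close
  (subst (⌊ a /2⌋ + ⌈ b /2⌉ ≤_) (+-suc ⌈ a /2⌉ ⌊ b /2⌋) (+-mono-≤ (⌊n/2⌋≤⌈n/2⌉ a) (⌈n/2⌉≤1+⌊n/2⌋ b)))
  (+-mono-≤ (⌈n/2⌉≤1+⌊n/2⌋ a) (⌊n/2⌋≤⌈n/2⌉ b))

Halves : ℕ → ℕ → ℕ → Set
Halves n x y = (x ≡ ⌊ n /2⌋ × y ≡ ⌈ n /2⌉) ⊎ (x ≡ ⌈ n /2⌉ × y ≡ ⌊ n /2⌋)

close⇒halves : ∀ x y → ∣ x - y ∣ ≤ 1 → Halves (x + y) x y
close⇒halves zero          zero          _     = inj₁ (refl , refl)
close⇒halves zero          (suc zero)    _     = inj₁ (refl , refl)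
close⇒halves (suc zero)    zero          _     = inj₂ (refl , refl)
close⇒halves zero          (suc (suc y)) (s≤s ())
close⇒halves (suc (suc x)) zero          (s≤s ())
close⇒halves (suc x)       (suc y)       close rewrite +-suc x y with close⇒halves x y close
... | inj₁ (ex , ey) = inj₁ (cong suc ex , cong suc ey)
... | inj₂ (ex , ey) = inj₂ (cong suc ex , cong suc ey)

halves-unique : ∀ {n x y x′ y′} → Halves n x y → Halves n x′ y′ → (x ≡ x′ × y ≡ y′) ⊎ (x ≡ y′ × y ≡ x′)
halves-unique (inj₁ (refl , refl)) (inj₁ (refl , refl)) = inj₁ (refl , refl)
halves-unique (inj₁ (refl , refl)) (inj₂ (refl , refl)) = inj₂ (refl , refl)
halves-unique (inj₂ (refl , refl)) (inj₁ (refl , refl)) = inj₂ (refl , refl)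
halves-unique (inj₂ (refl , refl)) (inj₂ (refl , refl)) = inj₁ (refl , refl)

close-split-unique : ∀ {x y x′ y′} → ∣ x - y ∣ ≤ 1 → ∣ x′ - y′ ∣ ≤ 1 → x + y ≡ x′ + y′ →
  (x ≡ x′ × y ≡ y′) ⊎ (x ≡ y′ × y ≡ x′)
close-split-unique {x} {y} {x′} {y′} close close′ sum≡ =
  halves-unique (close⇒halves x y close) (subst (λ n → Halves n x′ y′) (sym sum≡) (close⇒halves x′ y′ close′))

grow : Tree → Tree
grow leaf       = node leaf leaf
grow (node l r) with leaves r <? leaves l
... | yes _ = node l (grow r)
... | no  _ = node (grow l) r

leaves-grow : ∀ t → leaves (grow t) ≡ suc (leaves t)
leaves-grow leaf       = refl
leaves-grow (node l r) with leaves r <? leaves l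
... | yes _ = trans (cong (leaves l +_) (leaves-grow r)) (+-suc (leaves l) (leaves r))
... | no  _ = cong (_+ leaves r) (leaves-grow l)

grow-balanced : ∀ t → AllMaxBalanced t → AllMaxBalanced (grow t)
grow-balanced leaf       _                 = z≤n , tt , tt
grow-balanced (node l r) (close , bl , br) with leaves r <? leaves l
... | yes r<l = subst (λ m → ∣ leaves l - m ∣ ≤ 1) (sym (leaves-grow r))
                      (≤suc⇒close (m≤n⇒m≤1+n (close⇒≤suc close)) (m≤n⇒m≤1+n r<l))
              , bl , grow-balanced r br
... | no  r≮l = subst (λ m → ∣ m - leaves r ∣ ≤ 1) (sym (leaves-grow l))
                      (≤suc⇒close (s≤s (≮⇒≥ r≮l))
                                  (m≤n⇒m≤1+n (close⇒≤suc (subst (_≤ 1) (∣-∣-comm (leaves l) _) close))))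
              , grow-balanced l bl , br

balancedTree : ℕ → Tree
balancedTree zero    = leaf
balancedTree (suc n) = grow (balancedTree n)

leaves-balancedTree : ∀ n → leaves (balancedTree n) ≡ suc n
leaves-balancedTree zero    = refl
leaves-balancedTree (suc n) = trans (leaves-grow (balancedTree n)) (cong suc (leaves-balancedTree n))

balancedTree-balanced : ∀ n → AllMaxBalanced (balancedTree n)
balancedTree-balanced zero    = tt
balancedTree-balanced (suc n) = grow-balanced (balancedTree n) (balancedTree-balanced n)

leaves-node≢1 : ∀ l r → leaves (node l r) ≢ 1
leaves-node≢1 l r with leaves l | leaves-nonzero l | leaves r | leaves-nonzero r
... | _ | m , refl | _ | n , refl = λ eq → 0≢1+n (sym (trans (sym (+-suc m n)) (suc-injective eq)))

balanced-profile-unique : ∀ t t′ → AllMaxBalanced t → AllMaxBalanced t′ → leaves t ≡ leaves t′ →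
  profile t ≡ profile t′
balanced-profile-unique leaf       leaf         _ _ _  = refl
balanced-profile-unique leaf       (node l r)   _ _ eq = ⊥-elim (leaves-node≢1 l r (sym eq))
balanced-profile-unique (node l r) leaf         _ _ eq = ⊥-elim (leaves-node≢1 l r eq)
balanced-profile-unique (node l r) (node l′ r′) (close , bl , br) (close′ , bl′ , br′) eq
  with close-split-unique close close′ eq
... | inj₁ (l≡l′ , r≡r′) = begin
  profile (node l r)      ≡⟨ profile-node l r ⟩
  profile l ⊗ profile r   ≡⟨ cong₂ _⊗_ (balanced-profile-unique l l′ bl bl′ l≡l′)
                                       (balanced-profile-unique r r′ br br′ r≡r′) ⟩
  profile l′ ⊗ profile r′ ≡⟨ profile-node l′ r′ ⟨
  profile (node l′ r′)    ∎
  where open ≡-Reasoning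
... | inj₂ (l≡r′ , r≡l′) = begin
  profile (node l r)      ≡⟨ profile-node l r ⟩
  profile l ⊗ profile r   ≡⟨ cong₂ _⊗_ (balanced-profile-unique l r′ bl br′ l≡r′)
                                       (balanced-profile-unique r l′ br bl′ r≡l′) ⟩
  profile r′ ⊗ profile l′ ≡⟨ ⊗-comm (profile r′) (profile l′) ⟩
  profile l′ ⊗ profile r′ ≡⟨ profile-node l′ r′ ⟨
  profile (node l′ r′)    ∎
  where open ≡-Reasoning

-- For n = 0 this is the unit of ⊗, so that a half of a one-leaf tree may be empty.
balancedProfile : ℕ → Profile
balancedProfile zero    = ⟨ 0 , 0 , 0 ⟩
balancedProfile (suc n) = profile (balancedTree n)

size-balancedProfile : ∀ n → size (balancedProfile n) ≡ n
size-balancedProfile zero    = refl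
size-balancedProfile (suc n) = leaves-balancedTree n

⊗-identityˡ : ∀ p → balancedProfile 0 ⊗ p ≡ p
⊗-identityˡ ⟨ a , u , s ⟩ =
  ⟨⟩-cong refl (trans (cong (u +_) (*-zeroʳ a)) (+-identityʳ u))
               (trans (cong (s + 0 +_) (*-zeroʳ a)) (trans (+-identityʳ _) (+-identityʳ s)))

profile-balanced : ∀ t → AllMaxBalanced t → profile t ≡ balancedProfile (leaves t)
profile-balanced t balanced with leaves-nonzero t
... | m , eq = trans (balanced-profile-unique t (balancedTree m) balanced (balancedTree-balanced m)
                                              (trans eq (sym (leaves-balancedTree m))))
                     (cong balancedProfile (sym eq))

balancedProfile-split : ∀ x y → ∣ x - y ∣ ≤ 1 → balancedProfile (x + y) ≡ balancedProfile x ⊗ balancedProfile y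
balancedProfile-split zero          zero          _     = refl
balancedProfile-split zero          (suc zero)    _     = refl
balancedProfile-split (suc zero)    zero          _     = refl
balancedProfile-split zero          (suc (suc y)) (s≤s ())
balancedProfile-split (suc (suc x)) zero          (s≤s ())
balancedProfile-split (suc x)       (suc y)       close = begin
  balancedProfile (suc x + suc y)
    ≡⟨ cong balancedProfile (cong₂ _+_ (leaves-balancedTree x) (leaves-balancedTree y)) ⟨
  balancedProfile (leaves (node Bx By))
    ≡⟨ profile-balanced (node Bx By) balanced ⟨
  profile (node Bx By)
    ≡⟨ profile-node Bx By ⟩
  balancedProfile (suc x) ⊗ balancedProfile (suc y) ∎
  where
  open ≡-Reasoning
  Bx By : Tree
  Bx = balancedTree x
  By = balancedTree y
  balanced : AllMaxBalanced (node Bx By)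
  balanced = subst₂ (λ m n → ∣ m - n ∣ ≤ 1) (sym (leaves-balancedTree x)) (sym (leaves-balancedTree y)) close
           , balancedTree-balanced x , balancedTree-balanced y

balancedProfile-halves : ∀ n → balancedProfile n ≡ balancedProfile ⌊ n /2⌋ ⊗ balancedProfile ⌈ n /2⌉
balancedProfile-halves n =
  trans (cong balancedProfile (sym (⌊n/2⌋+⌈n/2⌉≡n n))) (balancedProfile-split ⌊ n /2⌋ ⌈ n /2⌉ (halves-close n))

-- Optimality of the balanced profile

OptimalAt : ℕ → Set
OptimalAt n = ∀ a b → a + b ≡ n → balancedProfile n ≼ balancedProfile a ⊗ balancedProfile b

balancedProfile-optimal-ordered : ∀ a b → (∀ {m} → m < a + b → OptimalAt m) → a ≤ b →
  balancedProfile (a + b) ≼ balancedProfile a ⊗ balancedProfile b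
balancedProfile-optimal-ordered zero      b _   _   = ≼-reflexive (sym (⊗-identityˡ (balancedProfile b)))
balancedProfile-optimal-ordered a@(suc _) b rec a≤b = begin
  P (a + b)
    ≡⟨ cong P a+b≡X+Y ⟩
  P (X + Y)
    ≡⟨ balancedProfile-split X Y (crossed-halves-close a b) ⟩
  P X ⊗ P Y
    ≲⟨ ⊗-mono (rec X<a+b ⌊ a /2⌋ ⌈ b /2⌉ refl) (rec Y<a+b ⌈ a /2⌉ ⌊ b /2⌋ refl) ⟩
  (P ⌊ a /2⌋ ⊗ P ⌈ b /2⌉) ⊗ (P ⌈ a /2⌉ ⊗ P ⌊ b /2⌋)
    ≲⟨ ⊗-regroup {P ⌊ a /2⌋} {P ⌈ a /2⌉} {P ⌊ b /2⌋} {P ⌈ b /2⌉}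
                 (sizes-≤ (⌊n/2⌋-mono a≤b)) (sizes-≤ (⌈n/2⌉-mono a≤b)) ⟩
  (P ⌊ a /2⌋ ⊗ P ⌈ a /2⌉) ⊗ (P ⌊ b /2⌋ ⊗ P ⌈ b /2⌉)
    ≡⟨ cong₂ _⊗_ (balancedProfile-halves a) (balancedProfile-halves b) ⟨
  P a ⊗ P b ∎
  where
  open import Relation.Binary.Reasoning.Preorder ≼-preorder
  P : ℕ → Profile
  P = balancedProfile
  X Y : ℕ
  X = ⌊ a /2⌋ + ⌈ b /2⌉
  Y = ⌈ a /2⌉ + ⌊ b /2⌋
  a+b≡X+Y : a + b ≡ X + Y
  a+b≡X+Y = trans (sym (cong₂ _+_ (⌊n/2⌋+⌈n/2⌉≡n a) (⌊n/2⌋+⌈n/2⌉≡n b)))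
                  (shuffle ⌊ a /2⌋ ⌈ a /2⌉ ⌊ b /2⌋ ⌈ b /2⌉)
    where
    shuffle : ∀ w x y z → (w + x) + (y + z) ≡ (w + z) + (x + y)
    shuffle = solve-∀
  X<a+b : X < a + b
  X<a+b = subst (X <_) (sym a+b≡X+Y) (m<m+n X (s≤s z≤n))
  Y<a+b : Y < a + b
  Y<a+b = subst (Y <_) (sym a+b≡X+Y)
                (m<n+m Y (≤-trans (≤-trans (s≤s z≤n) (⌈n/2⌉-mono a≤b)) (m≤n+m ⌈ b /2⌉ ⌊ a /2⌋)))
  sizes-≤ : ∀ {m n} → m ≤ n → size (P m) ≤ size (P n)
  sizes-≤ {m} {n} = subst₂ _≤_ (sym (size-balancedProfile m)) (sym (size-balancedProfile n))

balancedProfile-optimal : ∀ a b → balancedProfile (a + b) ≼ balancedProfile a ⊗ balancedProfile b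
balancedProfile-optimal a b = <-rec OptimalAt optimal (a + b) a b refl
  where
  optimal : ∀ n → (∀ {m} → m < n → OptimalAt m) → OptimalAt n
  optimal _ rec a b refl with ≤-total a b
  ... | inj₁ a≤b = balancedProfile-optimal-ordered a b rec a≤b
  ... | inj₂ b≤a =
    subst₂ _≼_ (cong balancedProfile (+-comm b a)) (⊗-comm (balancedProfile b) (balancedProfile a))
               (balancedProfile-optimal-ordered b a (λ {m} m<b+a → rec (subst (m <_) (+-comm b a) m<b+a)) b≤a)

balancedProfile-≼-profile : ∀ t → balancedProfile (leaves t) ≼ profile t
balancedProfile-≼-profile leaf       = ≼-reflexive refl
balancedProfile-≼-profile (node l r) = begin
  balancedProfile (leaves l + leaves r)                   ≲⟨ balancedProfile-optimal (leaves l) (leaves r) ⟩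
  balancedProfile (leaves l) ⊗ balancedProfile (leaves r) ≲⟨ ⊗-mono (balancedProfile-≼-profile l)
                                                                    (balancedProfile-≼-profile r) ⟩
  profile l ⊗ profile r                                   ≡⟨ profile-node l r ⟨
  profile (node l r)                                      ∎
  where open import Relation.Binary.Reasoning.Preorder ≼-preorder

theorem5p7 : (n : ℕ) → 7 ≤ n → (T T′ : Tree) → leaves T ≡ n → leaves T′ ≡ n →
    AllMaxBalanced T → c5 T ≤ c5 T′
theorem5p7 _ _ T T′ refl T′-leaves balanced = begin
  c5 T                                 ≡⟨ c5≡combs5 T ⟩
  combs₅ (profile T)                   ≡⟨ cong combs₅ (profile-balanced T balanced) ⟩
  combs₅ (balancedProfile (leaves T))  ≡⟨ cong (λ n → combs₅ (balancedProfile n)) T′-leaves ⟨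
  combs₅ (balancedProfile (leaves T′)) ≤⟨ combs₅≤ (balancedProfile-≼-profile T′) ⟩
  combs 5 T′                           ≡⟨ c5≡combs5 T′ ⟨
  c5 T′                                ∎
  where open ≤-Reasoning
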